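{- Let $\mathcal{F}=(W,\preccurlyeq,V_{\mathcal{F}})$ be a finite poset model, $w\in W$, and $\Phi_1,\Phi_2$ $\mathrm{SLCS}_\eta$ formulas. The following are equivalent: (1) there is a $\pm$-path $\pi:\{0,\dots,\ell\}\to W$ with $\pi(0)=w$, $\mathcal{F},\pi(\ell)\models\Phi_2$ and $\mathcal{F},\pi(i)\models\Phi_1$ for all $i\in\{0,\dots,\ell-1\}$; (2) there is a $\downarrow$-path $\pi:\{0,\dots,\ell'\}\to W$ with $\pi(0)=w$, $\mathcal{F},\pi(\ell')\models\Phi_2$ and $\mathcal{F},\pi(i)\models\Phi_1$ for all $i\in\{0,\dots,\ell'-1\}$.
   Context: $\mathcal{F}$: finite partial order $(W,\preccurlyeq)$ with $V_{\mathcal{F}}:PL\to2^W$. An undirected path of length $\ell$ is $\pi:\{0,\dots,\ell\}\to W$ with $\pi(i)\preccurlyeq\pi(i+1)$ or $\pi(i+1)\preccurlyeq\pi(i)$ for all $i<\ell$. A $\pm$-path is an undirected path with $\ell\ge2$, $\pi(0)\preccurlyeq\pi(1)$ and $\pi(\ell)\preccurlyeq\pi(\ell-1)$. A $\downarrow$-path is an undirected path with $\ell\ge1$ and $\pi(\ell)\preccurlyeq\pi(\ell-1)$. $\mathrm{SLCS}_\eta$: $\Phi::=p\mid\neg\Phi\mid\Phi_1\wedge\Phi_2\mid\eta(\Phi_1,\Phi_2)$, interpreted with $w\models p$ iff $w\in V_{\mathcal{F}}(p)$, Boolean connectives standard, and $w\models\eta(\Phi_1,\Phi_2)$ iff condition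 (1) above holds. -}

module Defs where

open import Data.Nat using (ℕ) renaming (suc to sucℕ)
open import Data.Fin using (Fin; zero; suc; inject₁; fromℕ)
open import Data.Product using (Σ; ∃; _×_; _,_)
open import Data.Sum using (_⊎_)
open import Data.Empty using (⊥)
open import Relation.Binary.Bundles using (Poset)
open import Relation.Binary.PropositionalEquality using (_≡_)

-- We take the carrier to be Fin n with a partial order on it,
-- using propositional equality as the underlying equality.
record FinitePoset : Set₁ where
  field
    size     : ℕ
    _≼_      : Fin size → Fin size → Set
    refl≼    : ∀ {x} → x ≼ x
    antisym≼ : ∀ {x y} → x ≼ y → y ≼ x → x ≡ y
    trans≼   : ∀ {x y z} → x ≼ y → y ≼ z → x ≼ z

record PosetModel (PL : Set) : Set₁ where
  field
    frame : FinitePoset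
  open FinitePoset frame public
  W : Set
  W = Fin size
  field
    V : PL → W → Set

data Formula (PL : Set) : Set where
  atom : PL → Formula PL
  ¬'   : Formula PL → Formula PL
  _∧'_ : Formula PL → Formula PL → Formula PL
  η    : Formula PL → Formula PL → Formula PL

module _ {PL : Set} (M : PosetModel PL) where
  open PosetModel M

  UndirectedPath : (ℓ : ℕ) → (Fin (sucℕ ℓ) → W) → Set
  UndirectedPath ℓ π = (i : Fin ℓ) → (π (inject₁ i) ≼ π (suc i)) ⊎ (π (suc i) ≼ π (inject₁ i))

  -- ±-path: ℓ ≥ 2, π(0) ≼ π(1), π(ℓ) ≼ π(ℓ-1)
  -- (for ℓ = k+1, the last step is indexed by fromℕ k : Fin (k+1), i.e. π(k) vs π(k+1))
  PMPath : (ℓ : ℕ) → (Fin (sucℕ ℓ) → W) → Set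
  PMPath 0 π = ⊥
  PMPath 1 π = ⊥
  PMPath (sucℕ (sucℕ k)) π = UndirectedPath (sucℕ (sucℕ k)) π ×
    (π zero ≼ π (suc zero)) ×
    (π (suc (fromℕ (sucℕ k))) ≼ π (inject₁ (fromℕ (sucℕ k))))

  DownPath : (ℓ : ℕ) → (Fin (sucℕ ℓ) → W) → Set
  DownPath 0 π = ⊥
  DownPath (sucℕ k) π = UndirectedPath (sucℕ k) π ×
    (π (suc (fromℕ k)) ≼ π (inject₁ (fromℕ k)))

  Reach : (W → Set) → (W → Set) → (ℓ : ℕ) → (Fin (sucℕ ℓ) → W) → W → Set
  Reach P₁ P₂ ℓ π w = (π zero ≡ w) × P₂ (π (fromℕ ℓ)) × ((i : Fin ℓ) → P₁ (π (inject₁ i)))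

  _⊨_ : W → Formula PL → Set
  w ⊨ atom p = V p w
  w ⊨ ¬' Φ = w ⊨ Φ → ⊥
  w ⊨ (Φ₁ ∧' Φ₂) = (w ⊨ Φ₁) × (w ⊨ Φ₂)
  w ⊨ η Φ₁ Φ₂ = Σ ℕ λ ℓ → Σ (Fin (sucℕ ℓ) → W) λ π →
    PMPath ℓ π × Reach (_⊨ Φ₁) (_⊨ Φ₂) ℓ π w

-- Every ±-path is a ↓-path; conversely, repeating the first point of a ↓-path
-- gives a ±-path (its new first step is an instance of reflexivity), and this
-- stuttering preserves the reachability condition.
module Submission where

open import Defs
open import Data.Nat using (ℕ; suc)
open import Data.Fin using (Fin; zero; inject₁) renaming (suc to fsuc)
open import Data.Product using (Σ; _×_; _,_)
open import Data.Sum using (inj₁)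
open import Data.Vec.Functional using (_∷_)
open import Function.Bundles using (_⇔_; mk⇔)

module _ {PL : Set} (M : PosetModel PL) where
  open PosetModel M

  PMPath⇒DownPath : ∀ {ℓ} {π : Fin (suc ℓ) → W} → PMPath M ℓ π → DownPath M ℓ π
  PMPath⇒DownPath {suc (suc k)} (undirected , _ , lastDown) = undirected , lastDown

  stutter : ∀ {ℓ} → (Fin (suc ℓ) → W) → Fin (suc (suc ℓ)) → W
  stutter π = π zero ∷ π

  stutter-UndirectedPath : ∀ {ℓ} {π : Fin (suc ℓ) → W} →
    UndirectedPath M ℓ π → UndirectedPath M (suc ℓ) (stutter π)
  stutter-UndirectedPath undirected zero     = inj₁ refl≼
  stutter-UndirectedPath undirected (fsuc i) = undirected i

  stutter-DownPath⇒PMPath : ∀ {ℓ} {π : Fin (suc ℓ) → W} →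
    DownPath M ℓ π → PMPath M (suc ℓ) (stutter π)
  stutter-DownPath⇒PMPath {suc k} (undirected , lastDown) =
    stutter-UndirectedPath undirected , refl≼ , lastDown

  -- Length ≥ 1 is needed: the repeated point π zero must satisfy P₁, whereas on
  -- a path of length 0 it is the target.
  stutter-Reach : ∀ {P₁ P₂ : W → Set} {k} {π : Fin (suc (suc k)) → W} {w} →
    Reach M P₁ P₂ (suc k) π w → Reach M P₁ P₂ (suc (suc k)) (stutter π) w
  stutter-Reach {P₁} {k = k} {π} (start , target , before) = start , target , before′
    where
    before′ : (i : Fin (suc (suc k))) → P₁ (stutter π (inject₁ i))
    before′ zero     = before zero
    before′ (fsuc i) = before i

  module _ (P₁ P₂ : W → Set) (w : W) where

    Reachable : ((ℓ : ℕ) → (Fin (suc ℓ) → W) → Set) → Set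
    Reachable Path = Σ ℕ λ ℓ → Σ (Fin (suc ℓ) → W) λ π → Path ℓ π × Reach M P₁ P₂ ℓ π w

    Reachable-PMPath⇒DownPath : Reachable (PMPath M) → Reachable (DownPath M)
    Reachable-PMPath⇒DownPath (ℓ , π , pm , reach) = ℓ , π , PMPath⇒DownPath pm , reach

    Reachable-DownPath⇒PMPath : Reachable (DownPath M) → Reachable (PMPath M)
    Reachable-DownPath⇒PMPath (suc k , π , down , reach) =
      suc (suc k) , stutter π , stutter-DownPath⇒PMPath down , stutter-Reach {P₁} {P₂} reach

proposition3p11 : {PL : Set} (M : PosetModel PL) (w : PosetModel.W M) (Φ₁ Φ₂ : Formula PL) →
    (Σ ℕ λ ℓ → Σ (Fin (suc ℓ) → PosetModel.W M) λ π →
       PMPath M ℓ π × Reach M (λ v → _⊨_ M v Φ₁) (λ v → _⊨_ M v Φ₂) ℓ π w)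
    ⇔
    (Σ ℕ λ ℓ′ → Σ (Fin (suc ℓ′) → PosetModel.W M) λ π →
       DownPath M ℓ′ π × Reach M (λ v → _⊨_ M v Φ₁) (λ v → _⊨_ M v Φ₂) ℓ′ π w)
proposition3p11 M w Φ₁ Φ₂ = mk⇔
  (Reachable-PMPath⇒DownPath M (λ v → _⊨_ M v Φ₁) (λ v → _⊨_ M v Φ₂) w)
  (Reachable-DownPath⇒PMPath M (λ v → _⊨_ M v Φ₁) (λ v → _⊨_ M v Φ₂) w)
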